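{- Let $k\in\mathbb{N}$ and let $A\subseteq\mathbb{N}$ with $\min(A)=0$ and $\max(A)\le k$. If $B$ and $D$ are different additive divisors of $A$, then $F(B)\cap F(D)=\emptyset$.
   Context: $\mathbb{N}=\{0,1,2,\ldots\}$, $[k]=\{0,1,\ldots,k\}$, and $X+Y=\{x+y:x\in X,y\in Y\}$. A set $B\subseteq\mathbb{N}$ is an additive divisor of $A$ if $B+C=A$ for some $C\subseteq\mathbb{N}$. For sets $X,Y\subseteq\mathbb{N}$ with $X+Y=A$, define (relative to $k$ and $A$) the promotion $Y_X = Y\cup\{s\in[k]\setminus A: s<\max(X)\}\cup\{s-\max(X): s\in[k]\setminus A,\ s\ge\max(X)\}$. For an additive divisor $B$ of $A$, $F(B)$ is the collection of sets consisting of: the set $B$ itself, provided there exists $C\subseteq\mathbb{N}$ with $B+C=A$ and $\max(B)\le\max(C)$; and the set $B_C$ for every $C\subseteq\mathbb{N}$ with $B+C=A$ and $\max(C)\le\max(B)$. -}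

module Defs where

open import Data.Nat using (ℕ; _+_; _≤_; _<ᵇ_; _≤ᵇ_)
open import Data.Bool using (Bool; true; false; _∧_; _∨_; not)
open import Data.Product using (Σ; _×_; ∃; ∃-syntax)
open import Data.Sum using (_⊎_)
open import Relation.Binary.PropositionalEquality using (_≡_)

SetN : Set
SetN = ℕ → Bool

infix 4 _∈_
_∈_ : ℕ → SetN → Set
n ∈ X = X n ≡ true

infix 4 _≐_
_≐_ : SetN → SetN → Set
X ≐ Y = ∀ n → X n ≡ Y n

SumsetEq : SetN → SetN → SetN → Set
SumsetEq X Y A =
  ∀ n → (n ∈ A → ∃[ x ] ∃[ y ] (x ∈ X × y ∈ Y × x + y ≡ n))
      × ((∃[ x ] ∃[ y ] (x ∈ X × y ∈ Y × x + y ≡ n)) → n ∈ A)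

IsMax : SetN → ℕ → Set
IsMax X m = m ∈ X × (∀ x → x ∈ X → x ≤ m)

IsMin : SetN → ℕ → Set
IsMin X m = m ∈ X × (∀ x → x ∈ X → m ≤ x)

IsAdditiveDivisor : SetN → SetN → Set
IsAdditiveDivisor B A = ∃[ C ] SumsetEq B C A

-- Promotion Y_X relative to k and A, where m = max(X):
-- Y ∪ {s ∈ [k]∖A : s < m} ∪ {s − m : s ∈ [k]∖A, s ≥ m}
promotion : ℕ → SetN → SetN → ℕ → SetN
promotion k A Y m t =
  Y t ∨ ((t ≤ᵇ k) ∧ not (A t) ∧ (t <ᵇ m))
      ∨ (((t + m) ≤ᵇ k) ∧ not (A (t + m)))

InF : ℕ → SetN → SetN → SetN → Set
InF k A B E =
  (E ≐ B × ∃[ C ] ∃[ mB ] ∃[ mC ]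
      (SumsetEq B C A × IsMax B mB × IsMax C mC × mB ≤ mC))
  ⊎ (∃[ C ] ∃[ mB ] ∃[ mC ]
      (SumsetEq B C A × IsMax B mB × IsMax C mC × mC ≤ mB
        × E ≐ promotion k A B mC))

-- If E ∈ F(B) through a complement C of B with c = max C, then B is recovered from E
-- as {t ∈ E : t ∈ A and t + c ∈ A}: B + {0, c} ⊆ A puts B inside this set, and the
-- promotion only adds points t with t ∉ A or t + c ∉ A. It remains to see that c is
-- determined by E. With m = max A: if E = B then max E + c = m and max E ≤ c; if E is
-- the promotion B_C then max E = k − c and 2c ≤ m. Either pair of constraints fixes c
-- given max E, and since m ≤ k the two cases cannot yield different values of c.
module Submission where

open import Defs
open import Data.Nat using (ℕ; _≤_)
open import Data.Product using (_×_; ∃-syntax)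
open import Data.Empty using (⊥)
open import Relation.Nullary using (¬_)

open import Data.Bool using (Bool; true; false; _∧_; not)
open import Data.Bool.Properties using (T-≡; T-not-≡; T-∧; T-∨; ⇔→≡)
open import Data.Nat using (_+_; _∸_; _<_; _≤ᵇ_; _<ᵇ_)
open import Data.Nat.Properties
open import Data.Product using (_,_; proj₁; proj₂)
open import Data.Sum using (_⊎_; inj₁; inj₂)
open import Function.Bundles using (Equivalence; mk⇔)
open import Relation.Binary.PropositionalEquality
open import Relation.Nullary using (contradiction)

open Equivalence using (to; from)

IsMax-unique : ∀ {X a b} → IsMax X a → IsMax X b → a ≡ b
IsMax-unique (a∈X , ≤a) (b∈X , ≤b) = ≤-antisym (≤b _ a∈X) (≤a _ b∈X)

IsMax-resp-≐ : ∀ {X Y m} → X ≐ Y → IsMax Y m → IsMax X m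
IsMax-resp-≐ X≐Y (m∈Y , ≤m) = trans (X≐Y _) m∈Y , λ x x∈X → ≤m x (trans (sym (X≐Y x)) x∈X)

double-cancel-≤ : ∀ {a b} → a + a ≤ b + b → a ≤ b
double-cancel-≤ a+a≤b+b = ≮⇒≥ (λ b<a → <⇒≱ (+-mono-< b<a b<a) a+a≤b+b)

module SumsetEq-Properties {A B C : SetN} (S : SumsetEq B C A) (0∈A : 0 ∈ A) where

  0∈C : 0 ∈ C
  0∈C with proj₁ (S 0) 0∈A
  ... | x , y , _ , y∈C , x+y≡0 = subst (_∈ C) (m+n≡0⇒n≡0 x x+y≡0) y∈C

  +-closed : ∀ {x y} → x ∈ B → y ∈ C → x + y ∈ A
  +-closed {x} {y} x∈B y∈C = proj₂ (S (x + y)) (x , y , x∈B , y∈C , refl)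

  B⊆A : ∀ {x} → x ∈ B → x ∈ A
  B⊆A {x} x∈B = subst (_∈ A) (+-identityʳ x) (+-closed x∈B 0∈C)

  max-+ : ∀ {m mB mC} → IsMax A m → IsMax B mB → IsMax C mC → mB + mC ≡ m
  max-+ {m} {mB} {mC} (m∈A , ≤m) (mB∈B , ≤mB) (mC∈C , ≤mC) =
    ≤-antisym (≤m _ (+-closed mB∈B mC∈C)) m≤mB+mC
    where
    m≤mB+mC : m ≤ mB + mC
    m≤mB+mC with proj₁ (S m) m∈A
    ... | x , y , x∈B , y∈C , x+y≡m = subst (_≤ mB + mC) x+y≡m (+-mono-≤ (≤mB x x∈B) (≤mC y y∈C))

module Promotion (k : ℕ) (A Y : SetN) (m : ℕ) where

  lowGap : ℕ → Bool
  lowGap t = (t ≤ᵇ k) ∧ not (A t) ∧ (t <ᵇ m)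

  ⊆promotion : ∀ {t} → t ∈ Y → t ∈ promotion k A Y m
  ⊆promotion t∈Y rewrite t∈Y = refl

  shiftedGap∈promotion : ∀ {t} → A (t + m) ≡ false → t + m ≤ k → t ∈ promotion k A Y m
  shiftedGap∈promotion {t} gap t+m≤k = T-≡ .to (T-∨ {Y t} .from (inj₂
    (T-∨ {lowGap t} .from (inj₂ (T-∧ {t + m ≤ᵇ k} .from (≤⇒≤ᵇ t+m≤k , T-not-≡ .from gap))))))

  promotion-cases : ∀ {t} → t ∈ promotion k A Y m →
    t ∈ Y ⊎ (A t ≡ false × t < m) ⊎ (A (t + m) ≡ false × t + m ≤ k)
  promotion-cases {t} t∈P with T-∨ {Y t} .to (T-≡ .from t∈P)
  ... | inj₁ t∈Y = inj₁ (T-≡ .to t∈Y)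
  ... | inj₂ gap with T-∨ {lowGap t} .to gap
  ...   | inj₁ low = let (notA , t<m) = T-∧ {not (A t)} .to (proj₂ (T-∧ {t ≤ᵇ k} .to low))
                     in inj₂ (inj₁ (T-not-≡ .to notA , <ᵇ⇒< t m t<m))
  ...   | inj₂ high = let (t+m≤k , notA) = T-∧ {t + m ≤ᵇ k} .to high
                      in inj₂ (inj₂ (T-not-≡ .to notA , ≤ᵇ⇒≤ (t + m) k t+m≤k))

  promotion-⊆-when-no-gap : ∀ {t} → t ∈ promotion k A Y m → t ∈ A → t + m ∈ A → t ∈ Y
  promotion-⊆-when-no-gap t∈P t∈A t+m∈A with promotion-cases t∈P
  ... | inj₁ t∈Y = t∈Y
  ... | inj₂ (inj₁ (gap , _)) = contradiction (trans (sym gap) t∈A) λ ()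
  ... | inj₂ (inj₂ (gap , _)) = contradiction (trans (sym gap) t+m∈A) λ ()

recoverDivisor : SetN → ℕ → SetN → SetN
recoverDivisor A c E t = E t ∧ A t ∧ A (t + c)

recoverDivisor-≐ : ∀ {A B E c} → (∀ {t} → t ∈ B → t ∈ E × t ∈ A × t + c ∈ A) →
  (∀ {t} → t ∈ E → t ∈ A → t + c ∈ A → t ∈ B) → B ≐ recoverDivisor A c E
recoverDivisor-≐ {A} {B} {E} {c} sound complete t = ⇔→≡ (mk⇔ forward backward)
  where
  forward : t ∈ B → recoverDivisor A c E t ≡ true
  forward t∈B = let (t∈E , t∈A , t+c∈A) = sound t∈B
                in T-≡ .to (T-∧ .from (T-≡ .from t∈E , T-∧ .from (T-≡ .from t∈A , T-≡ .from t+c∈A)))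
  backward : recoverDivisor A c E t ≡ true → t ∈ B
  backward r = let (t∈E , rest) = T-∧ .to (T-≡ .from r)
                   (t∈A , t+c∈A) = T-∧ .to rest
               in complete (T-≡ .to t∈E) (T-≡ .to t∈A) (T-≡ .to t+c∈A)

-- The two ways max E and c = max C can be related, for E = B and for E = B_C respectively.
Shape : ℕ → ℕ → ℕ → ℕ → Set
Shape k m top c = (top + c ≡ m × top ≤ c) ⊎ (top + c ≡ k × c + c ≤ m)

Shape-unique : ∀ {k m top c₁ c₂} → m ≤ k → Shape k m top c₁ → Shape k m top c₂ → c₁ ≡ c₂
Shape-unique {top = top} _ (inj₁ (e₁ , _)) (inj₁ (e₂ , _)) = +-cancelˡ-≡ top _ _ (trans e₁ (sym e₂))
Shape-unique {top = top} _ (inj₂ (e₁ , _)) (inj₂ (e₂ , _)) = +-cancelˡ-≡ top _ _ (trans e₁ (sym e₂))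
Shape-unique m≤k (inj₁ s₁) (inj₂ s₂) = mixed m≤k s₁ s₂
  where
  mixed : ∀ {k m top c₁ c₂} → m ≤ k → top + c₁ ≡ m × top ≤ c₁ → top + c₂ ≡ k × c₂ + c₂ ≤ m → c₁ ≡ c₂
  mixed {top = top} {c₁} {c₂} m≤k (e₁ , top≤c₁) (e₂ , 2c₂≤m) = ≤-antisym
    (+-cancelˡ-≤ top c₁ c₂ (subst₂ _≤_ (sym e₁) (sym e₂) m≤k))
    (double-cancel-≤ (≤-trans 2c₂≤m (subst (_≤ c₁ + c₁) e₁ (+-monoˡ-≤ c₁ top≤c₁))))
Shape-unique m≤k (inj₂ s₂) (inj₁ s₁) = sym (Shape-unique m≤k (inj₁ s₁) (inj₂ s₂))

record InFTrace (k m : ℕ) (A B E : SetN) : Set where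
  field
    c top : ℕ
    top-max : IsMax E top
    recovered : B ≐ recoverDivisor A c E
    shape : Shape k m top c

module _ {k m : ℕ} {A B C : SetN} (S : SumsetEq B C A) (0∈A : 0 ∈ A)
         (maxA : IsMax A m) (m≤k : m ≤ k) {mB mC : ℕ} (maxB : IsMax B mB) (maxC : IsMax C mC)
  where
  open SumsetEq-Properties S 0∈A
  open Promotion k A B mC

  mB+mC≡m : mB + mC ≡ m
  mB+mC≡m = max-+ maxA maxB maxC

  unpromoted-trace : ∀ {E} → E ≐ B → mB ≤ mC → InFTrace k m A B E
  unpromoted-trace E≐B mB≤mC = record
    { c = mC ; top = mB
    ; top-max = IsMax-resp-≐ E≐B maxB
    ; recovered = recoverDivisor-≐ (λ t∈B → trans (E≐B _) t∈B , B⊆A t∈B , +-closed t∈B (proj₁ maxC))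
                                   (λ t∈E _ _ → trans (sym (E≐B _)) t∈E)
    ; shape = inj₁ (mB+mC≡m , mB≤mC) }

  top+mC≡k : k ∸ mC + mC ≡ k
  top+mC≡k = m∸n+n≡m (≤-trans (m≤n+m mC mB) (subst (_≤ k) (sym mB+mC≡m) m≤k))

  promotion-max : mC ≤ mB → IsMax (promotion k A B mC) (k ∸ mC)
  promotion-max mC≤mB = top∈P , ≤top
    where
    top∈P : k ∸ mC ∈ promotion k A B mC
    top∈P with A k in Ak
    ... | true = ⊆promotion (subst (_∈ B) mB≡top (proj₁ maxB))
      where
      mB≡top : mB ≡ k ∸ mC
      mB≡top = +-cancelʳ-≡ mC mB (k ∸ mC)
        (trans mB+mC≡m (trans (≤-antisym m≤k (proj₂ maxA k Ak)) (sym top+mC≡k)))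
    ... | false = shiftedGap∈promotion (subst (λ u → A u ≡ false) (sym top+mC≡k) Ak)
                                       (≤-reflexive top+mC≡k)
    below-mB : ∀ {e} → e ≤ mB → e + mC ≤ k
    below-mB e≤mB = ≤-trans (+-monoˡ-≤ mC e≤mB) (subst (_≤ k) (sym mB+mC≡m) m≤k)
    ≤top : ∀ e → e ∈ promotion k A B mC → e ≤ k ∸ mC
    ≤top e e∈P = m+n≤o⇒m≤o∸n e (bound (promotion-cases e∈P))
      where
      bound : e ∈ B ⊎ (A e ≡ false × e < mC) ⊎ (A (e + mC) ≡ false × e + mC ≤ k) → e + mC ≤ k
      bound (inj₁ e∈B) = below-mB (proj₂ maxB e e∈B)
      bound (inj₂ (inj₁ (_ , e<mC))) = below-mB (≤-trans (<⇒≤ e<mC) mC≤mB)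
      bound (inj₂ (inj₂ (_ , e+mC≤k))) = e+mC≤k

  promoted-trace : ∀ {E} → E ≐ promotion k A B mC → mC ≤ mB → InFTrace k m A B E
  promoted-trace E≐P mC≤mB = record
    { c = mC ; top = k ∸ mC
    ; top-max = IsMax-resp-≐ E≐P (promotion-max mC≤mB)
    ; recovered = recoverDivisor-≐
        (λ t∈B → trans (E≐P _) (⊆promotion t∈B) , B⊆A t∈B , +-closed t∈B (proj₁ maxC))
        (λ t∈E → promotion-⊆-when-no-gap (trans (sym (E≐P _)) t∈E))
    ; shape = inj₂ (top+mC≡k , 2mC≤m) }
    where
    2mC≤m : mC + mC ≤ m
    2mC≤m = subst (mC + mC ≤_) (trans (+-comm mC mB) mB+mC≡m) (+-monoʳ-≤ mC mC≤mB)

InF⇒trace : ∀ {k m A B E} → 0 ∈ A → IsMax A m → m ≤ k → InF k A B E → InFTrace k m A B E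
InF⇒trace 0∈A maxA m≤k (inj₁ (E≐B , _ , _ , _ , S , maxB , maxC , mB≤mC)) =
  unpromoted-trace S 0∈A maxA m≤k maxB maxC E≐B mB≤mC
InF⇒trace 0∈A maxA m≤k (inj₂ (_ , _ , _ , S , maxB , maxC , mC≤mB , E≐P)) =
  promoted-trace S 0∈A maxA m≤k maxB maxC E≐P mC≤mB

-- Membership in F(B) already supplies a complement of B.
mainTheorem4 : (k : ℕ) (A : SetN) → IsMin A 0 → (∃[ m ] (IsMax A m × m ≤ k)) →
    (B D : SetN) → IsAdditiveDivisor B A → IsAdditiveDivisor D A → ¬ (B ≐ D) →
    (E : SetN) → InF k A B E → InF k A D E → ⊥
mainTheorem4 k A (0∈A , _) (m , maxA , m≤k) B D _ _ B≉D E E∈FB E∈FD = B≉D B≐D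
  where
  module τ = InFTrace (InF⇒trace 0∈A maxA m≤k E∈FB)
  module σ = InFTrace (InF⇒trace 0∈A maxA m≤k E∈FD)

  same-c : τ.c ≡ σ.c
  same-c = Shape-unique m≤k τ.shape
             (subst (λ top → Shape k m top σ.c) (IsMax-unique σ.top-max τ.top-max) σ.shape)

  B≐D : B ≐ D
  B≐D n = begin
    B n                          ≡⟨ τ.recovered n ⟩
    recoverDivisor A τ.c E n     ≡⟨ cong (λ c → recoverDivisor A c E n) same-c ⟩
    recoverDivisor A σ.c E n     ≡⟨ σ.recovered n ⟨
    D n                          ∎
    where open ≡-Reasoning
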